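{- For any set $X \subseteq \mathbb{N}$, there is a set $A \subseteq \mathbb{N}$ with upper density $1$ such that all infinite subsets of $A$ compute $X$ uniformly, i.e.\ there is a single Turing functional $\Phi$ with $\Phi(B) = X$ for every infinite $B \subseteq A$.
   Context: The upper density of $A$ is $\limsup_{n\to\infty}\frac{|A\cap\{0,\ldots,n\}|}{n+1}$. -}

module Defs where

open import Data.Nat using (ℕ; zero; suc; _+_; _*_; _≤_)
open import Data.Bool using (Bool; true; false)
open import Data.Fin using (Fin)
open import Data.Vec using (Vec; []; _∷_; lookup)
open import Data.Product using (Σ; _×_; ∃-syntax)
open import Relation.Binary.PropositionalEquality using (_≡_)

Set⊆ℕ : Set
Set⊆ℕ = ℕ → Bool

χ : Bool → ℕ
χ true  = 1
χ false = 0

-- A Turing functional is a code of an oracle partial recursive function;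
-- the oracle is a total function ℕ → ℕ (here: the characteristic function
-- of the oracle set).

data Code : ℕ → Set where
  zeroᶜ : ∀ {n} → Code n
  succᶜ : Code 1
  projᶜ : ∀ {n} → Fin n → Code n
  oracleᶜ : Code 1
  compᶜ : ∀ {m n} → Code m → Vec (Code n) m → Code n
  precᶜ : ∀ {n} → Code n → Code (suc (suc n)) → Code (suc n)
  muᶜ   : ∀ {n} → Code (suc n) → Code n

mutual
  data Eval (o : ℕ → ℕ) : ∀ {n} → Code n → Vec ℕ n → ℕ → Set where
    ev-zero : ∀ {n} {xs : Vec ℕ n} → Eval o zeroᶜ xs 0
    ev-succ : ∀ {x} → Eval o succᶜ (x ∷ []) (suc x)
    ev-proj : ∀ {n} {i : Fin n} {xs} → Eval o (projᶜ i) xs (lookup xs i)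
    ev-oracle : ∀ {x} → Eval o oracleᶜ (x ∷ []) (o x)
    ev-comp : ∀ {m n} {f : Code m} {gs : Vec (Code n) m} {xs ys y} →
              EvalAll o gs xs ys → Eval o f ys y → Eval o (compᶜ f gs) xs y
    ev-prec-zero : ∀ {n} {f : Code n} {g} {xs y} →
              Eval o f xs y → Eval o (precᶜ f g) (0 ∷ xs) y
    ev-prec-suc : ∀ {n} {f : Code n} {g} {k xs r y} →
              Eval o (precᶜ f g) (k ∷ xs) r →
              Eval o g (k ∷ r ∷ xs) y →
              Eval o (precᶜ f g) (suc k ∷ xs) y
    ev-mu : ∀ {n} {f : Code (suc n)} {xs y} →
              MuSearch o f xs 0 y → Eval o (muᶜ f) xs y

  data EvalAll (o : ℕ → ℕ) {n : ℕ} : ∀ {m} → Vec (Code n) m → Vec ℕ n → Vec ℕ m → Set where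
    ea-[] : ∀ {xs} → EvalAll o [] xs []
    ea-∷  : ∀ {m} {g} {gs : Vec (Code n) m} {xs y ys} →
            Eval o g xs y → EvalAll o gs xs ys → EvalAll o (g ∷ gs) xs (y ∷ ys)

  data MuSearch (o : ℕ → ℕ) {n : ℕ} (f : Code (suc n)) (xs : Vec ℕ n) : ℕ → ℕ → Set where
    mu-found : ∀ {k} → Eval o f (k ∷ xs) 0 → MuSearch o f xs k k
    mu-next  : ∀ {k v y} → Eval o f (k ∷ xs) (suc v) →
               MuSearch o f xs (suc k) y → MuSearch o f xs k y

Computes : Code 1 → Set⊆ℕ → Set⊆ℕ → Set
Computes Φ B X = ∀ n → Eval (λ k → χ (B k)) Φ (n ∷ []) (χ (X n))

count : Set⊆ℕ → ℕ → ℕ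
count A zero    = χ (A 0)
count A (suc n) = χ (A (suc n)) + count A n

-- upper density of A equals 1:
-- limsup_n count A n / (n+1) = 1.  Since the ratio is always ≤ 1, this says:
-- for every k, there are infinitely many n with count A n / (n+1) ≥ k/(k+1).
UpperDensityOne : Set⊆ℕ → Set
UpperDensityOne A = ∀ (k m : ℕ) → ∃[ n ] (m ≤ n × k * suc n ≤ suc k * count A n)

_⊆_ : Set⊆ℕ → Set⊆ℕ → Set
B ⊆ A = ∀ k → B k ≡ true → A k ≡ true

Infinite : Set⊆ℕ → Set
Infinite B = ∀ m → ∃[ k ] (m ≤ k × B k ≡ true)

{-# OPTIONS --safe #-}
-- Cut ℕ into consecutive blocks [F t, F (t+1)) with F (t+1) = (t+1)·F t + 1, so that block t
-- is t times longer than everything before it.  Let A be the union of the blocks whose index t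
-- is the binary code of an initial segment X↾ℓ (digits X 0, …, X (ℓ-1), then a leading 1
-- marking the length).  These indices are arbitrarily large, so A has upper density 1.
-- Given an infinite B ⊆ A and x, search for the first y ∈ B whose block index is at least
-- 2^(x+1); that index codes some X↾ℓ with x < ℓ, and its x-th binary digit is X x.
module Submission where

open import Defs
open import Data.Bool using (true; false)
open import Data.Bool.Properties using (T-≡)
open import Data.Fin using () renaming (zero to fzero; suc to fsuc)
open import Data.Nat using (ℕ; zero; suc; _+_; _*_; _∸_; _^_; _≤_; _<_; z≤n; s≤s; pred)
open import Data.Nat.Properties
open import Data.Nat.Tactic.RingSolver using (solve-∀)
open import Data.Product using (_×_; ∃-syntax; _,_; proj₁; proj₂)
open import Data.Sum using (inj₁; inj₂)
open import Data.Vec using (Vec; []; _∷_)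
open import Function using (_∘_)
open import Function.Bundles using (Equivalence)
open import Relation.Nullary using (Dec; yes; no; contradiction)
open import Relation.Nullary.Decidable using (isYes; toWitness; fromWitness)
open import Relation.Binary.PropositionalEquality

parity : ℕ → ℕ
parity zero    = 0
parity (suc n) = 1 ∸ parity n

half : ℕ → ℕ
half zero    = 0
half (suc n) = half n + parity n

-- halves x t = ⌊ t / 2^x ⌋, so parity (halves x t) is the x-th binary digit of t.
halves : ℕ → ℕ → ℕ
halves zero    t = t
halves (suc x) t = half (halves x t)

blockStart : ℕ → ℕ
blockStart zero    = 0
blockStart (suc t) = suc (suc t * blockStart t)

encode : ℕ → Set⊆ℕ → ℕ
encode zero    X = 1
encode (suc ℓ) X = χ (X 0) + 2 * encode ℓ (X ∘ suc)

one : ∀ {n} → Code n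
one = compᶜ succᶜ (zeroᶜ ∷ [])

comp₁ : ∀ {n} → Code 1 → Code n → Code n
comp₁ f g = compᶜ f (g ∷ [])

comp₂ : ∀ {n} → Code 2 → Code n → Code n → Code n
comp₂ f g₁ g₂ = compᶜ f (g₁ ∷ g₂ ∷ [])

π₀ : ∀ {n} → Code (suc n)
π₀ = projᶜ fzero

π₁ : ∀ {n} → Code (suc (suc n))
π₁ = projᶜ (fsuc fzero)

π₂ : ∀ {n} → Code (suc (suc (suc n)))
π₂ = projᶜ (fsuc (fsuc fzero))

module _ {o : ℕ → ℕ} where

  eval-one : ∀ {n} {xs : Vec ℕ n} → Eval o one xs 1
  eval-one = ev-comp (ea-∷ ev-zero ea-[]) ev-succ

  eval-comp₁ : ∀ {n f g} {xs : Vec ℕ n} {y z} →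
               Eval o g xs y → Eval o f (y ∷ []) z → Eval o (comp₁ f g) xs z
  eval-comp₁ g↓ f↓ = ev-comp (ea-∷ g↓ ea-[]) f↓

  eval-comp₂ : ∀ {n f g₁ g₂} {xs : Vec ℕ n} {y₁ y₂ z} →
               Eval o g₁ xs y₁ → Eval o g₂ xs y₂ → Eval o f (y₁ ∷ y₂ ∷ []) z →
               Eval o (comp₂ f g₁ g₂) xs z
  eval-comp₂ g₁↓ g₂↓ f↓ = ev-comp (ea-∷ g₁↓ (ea-∷ g₂↓ ea-[])) f↓

  eval-prec₀ : ∀ {f g} (F : ℕ → ℕ) → Eval o f [] (F 0) →
               (∀ {k} → Eval o g (k ∷ F k ∷ []) (F (suc k))) →
               ∀ k → Eval o (precᶜ f g) (k ∷ []) (F k)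
  eval-prec₀ F base step zero    = ev-prec-zero base
  eval-prec₀ F base step (suc k) = ev-prec-suc (eval-prec₀ F base step k) step

  eval-prec₁ : ∀ {f g} (F : ℕ → ℕ → ℕ) → (∀ {x} → Eval o f (x ∷ []) (F 0 x)) →
               (∀ {k x} → Eval o g (k ∷ F k x ∷ x ∷ []) (F (suc k) x)) →
               ∀ k x → Eval o (precᶜ f g) (k ∷ x ∷ []) (F k x)
  eval-prec₁ F base step zero    x = ev-prec-zero base
  eval-prec₁ F base step (suc k) x = ev-prec-suc (eval-prec₁ F base step k x) step

  module _ {n} {f : Code (suc n)} {xs : Vec ℕ n}
           (P : ℕ → ℕ) (f↓ : ∀ z → Eval o f (z ∷ xs) (P z)) where

    eval-μ-least : ∀ {y} → P y ≡ 0 → (∀ {z} → z < y → P z ≢ 0) → Eval o (muᶜ f) xs y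
    eval-μ-least {y} Py≡0 below = ev-mu (search y (+-identityʳ y))
      where
      search : ∀ d {k} → d + k ≡ y → MuSearch o f xs k y
      search zero    refl = mu-found (subst (Eval o f _) Py≡0 (f↓ y))
      search (suc d) {k} refl with P k in Pk | f↓ k
      ... | zero  | _   = contradiction Pk (below (s≤s (m≤n+m k d)))
      ... | suc _ | f↓k = mu-next f↓k (search d (+-suc d k))

    eval-μ-some : ∀ w → P w ≡ 0 → ∃[ y ] (Eval o (muᶜ f) xs y × P y ≡ 0)
    eval-μ-some w Pw≡0 =
      let y , s , Py≡0 = search w (subst (λ m → P m ≡ 0) (sym (+-identityʳ w)) Pw≡0)
      in  y , ev-mu s , Py≡0
      where
      search : ∀ d {k} → P (d + k) ≡ 0 → ∃[ y ] (MuSearch o f xs k y × P y ≡ 0)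
      search zero    Pk≡0 = _ , mu-found (subst (Eval o f _) Pk≡0 (f↓ _)) , Pk≡0
      search (suc d) {k} P≡0 with P k in Pk | f↓ k
      ... | zero  | f↓k = k , mu-found f↓k , Pk
      ... | suc _ | f↓k =
        let y , s , Py≡0 = search d (subst (λ m → P m ≡ 0) (sym (+-suc d k)) P≡0)
        in  y , mu-next f↓k s , Py≡0

addᶜ : Code 2
addᶜ = precᶜ π₀ (comp₁ succᶜ π₁)

mulᶜ : Code 2
mulᶜ = precᶜ zeroᶜ (comp₂ addᶜ π₂ π₁)

predᶜ : Code 1
predᶜ = precᶜ zeroᶜ π₀

monusᶜ : Code 2
monusᶜ = precᶜ π₀ (comp₁ predᶜ π₁)

parityᶜ : Code 1
parityᶜ = precᶜ zeroᶜ (comp₂ monusᶜ π₁ one)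

halfᶜ : Code 1
halfᶜ = precᶜ zeroᶜ (comp₂ addᶜ π₁ (comp₁ parityᶜ π₀))

halvesᶜ : Code 2
halvesᶜ = precᶜ π₀ (comp₁ halfᶜ π₁)

blockStartᶜ : Code 1
blockStartᶜ = precᶜ zeroᶜ (comp₁ succᶜ (comp₂ mulᶜ (comp₁ succᶜ π₀) π₁))

module _ {o : ℕ → ℕ} where

  eval-add : ∀ k x → Eval o addᶜ (k ∷ x ∷ []) (k + x)
  eval-add = eval-prec₁ _+_ ev-proj (eval-comp₁ ev-proj ev-succ)

  eval-mul : ∀ k x → Eval o mulᶜ (k ∷ x ∷ []) (k * x)
  eval-mul = eval-prec₁ _*_ ev-zero (eval-comp₂ ev-proj ev-proj (eval-add _ _))

  eval-pred : ∀ k → Eval o predᶜ (k ∷ []) (pred k)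
  eval-pred = eval-prec₀ pred ev-zero ev-proj

  eval-monus : ∀ k x → Eval o monusᶜ (k ∷ x ∷ []) (x ∸ k)
  eval-monus = eval-prec₁ (λ k x → x ∸ k) ev-proj
    (λ {k} {x} → subst (Eval o _ _) (pred[m∸n]≡m∸[1+n] x k) (eval-comp₁ ev-proj (eval-pred _)))

  eval-parity : ∀ k → Eval o parityᶜ (k ∷ []) (parity k)
  eval-parity = eval-prec₀ parity ev-zero (eval-comp₂ ev-proj eval-one (eval-monus _ 1))

  eval-half : ∀ k → Eval o halfᶜ (k ∷ []) (half k)
  eval-half = eval-prec₀ half ev-zero
    (eval-comp₂ ev-proj (eval-comp₁ ev-proj (eval-parity _)) (eval-add _ _))

  eval-halves : ∀ x t → Eval o halvesᶜ (x ∷ t ∷ []) (halves x t)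
  eval-halves = eval-prec₁ halves ev-proj (eval-comp₁ ev-proj (eval-half _))

  eval-blockStart : ∀ t → Eval o blockStartᶜ (t ∷ []) (blockStart t)
  eval-blockStart = eval-prec₀ blockStart ev-zero
    (eval-comp₁ (eval-comp₂ (eval-comp₁ ev-proj ev-succ) ev-proj (eval-mul _ _)) ev-succ)

blockStart-< : ∀ t → blockStart t < blockStart (suc t)
blockStart-< t = s≤s (m≤m+n (blockStart t) (t * blockStart t))

blockStart-mono : ∀ {s t} → s ≤ t → blockStart s ≤ blockStart t
blockStart-mono {zero}          _         = z≤n
blockStart-mono {suc s} {suc t} (s≤s s≤t) = s≤s (*-mono-≤ (s≤s s≤t) (blockStart-mono s≤t))

n≤blockStart : ∀ n → n ≤ blockStart n
n≤blockStart zero    = z≤n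
n≤blockStart (suc n) = ≤-<-trans (n≤blockStart n) (blockStart-< n)

level : ℕ → ℕ
level zero = 0
level (suc b) with suc b <? blockStart (suc (level b))
... | yes _ = level b
... | no  _ = suc (level b)

level-bounds : ∀ b → blockStart (level b) ≤ b × b < blockStart (suc (level b))
level-bounds zero = z≤n , s≤s z≤n
level-bounds (suc b) with suc b <? blockStart (suc (level b)) | level-bounds b
... | yes b+1<next | start≤b , _     = m≤n⇒m≤1+n start≤b , b+1<next
... | no  b+1≮next | _      , b<next =
  ≮⇒≥ b+1≮next , ≤-<-trans b<next (blockStart-< (suc (level b)))

level-≥ : ∀ {t b} → blockStart t ≤ b → t ≤ level b
level-≥ {t} {b} start≤b = ≮⇒≥ λ lb<t →
  <⇒≱ (proj₂ (level-bounds b)) (≤-trans (blockStart-mono lb<t) start≤b)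

level-≤ : ∀ {t b} → b < blockStart (suc t) → level b ≤ t
level-≤ {t} {b} b<next = ≮⇒≥ λ t<lb →
  <⇒≱ b<next (≤-trans (blockStart-mono t<lb) (proj₁ (level-bounds b)))

level-unique : ∀ {t b} → blockStart t ≤ b → b < blockStart (suc t) → level b ≡ t
level-unique start≤b b<next = ≤-antisym (level-≤ b<next) (level-≥ start≤b)

parity≤1 : ∀ n → parity n ≤ 1
parity≤1 zero    = z≤n
parity≤1 (suc n) = m∸n≤m 1 (parity n)

parity-χ : ∀ c → parity (χ c) ≡ χ c
parity-χ true  = refl
parity-χ false = refl

half-χ : ∀ c → half (χ c) ≡ 0
half-χ true  = refl
half-χ false = refl

parity-2+ : ∀ n → parity (2 + n) ≡ parity n
parity-2+ n = m∸[m∸n]≡n (parity≤1 n)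

half-2+ : ∀ n → half (2 + n) ≡ suc (half n)
half-2+ n = begin
  half n + parity n + (1 ∸ parity n)   ≡⟨ +-assoc (half n) (parity n) _ ⟩
  half n + (parity n + (1 ∸ parity n)) ≡⟨ cong (half n +_) (m+[n∸m]≡n (parity≤1 n)) ⟩
  half n + 1                           ≡⟨ +-comm (half n) 1 ⟩
  suc (half n)                         ∎
  where open ≡-Reasoning

+-2*-suc : ∀ b n → b + 2 * suc n ≡ 2 + (b + 2 * n)
+-2*-suc = solve-∀

parity-+2* : ∀ b n → parity (b + 2 * n) ≡ parity b
parity-+2* b zero    = cong parity (+-identityʳ b)
parity-+2* b (suc n) = begin
  parity (b + 2 * suc n)   ≡⟨ cong parity (+-2*-suc b n) ⟩
  parity (2 + (b + 2 * n)) ≡⟨ parity-2+ (b + 2 * n) ⟩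
  parity (b + 2 * n)       ≡⟨ parity-+2* b n ⟩
  parity b                 ∎
  where open ≡-Reasoning

half-+2* : ∀ b n → half (b + 2 * n) ≡ half b + n
half-+2* b zero    = trans (cong half (+-identityʳ b)) (sym (+-identityʳ (half b)))
half-+2* b (suc n) = begin
  half (b + 2 * suc n)   ≡⟨ cong half (+-2*-suc b n) ⟩
  half (2 + (b + 2 * n)) ≡⟨ half-2+ (b + 2 * n) ⟩
  suc (half (b + 2 * n)) ≡⟨ cong suc (half-+2* b n) ⟩
  suc (half b + n)       ≡⟨ +-suc (half b) n ⟨
  half b + suc n         ∎
  where open ≡-Reasoning

half-mono : ∀ {m n} → m ≤ n → half m ≤ half n
half-mono {n = zero}  z≤n   = z≤n
half-mono {n = suc n} m≤1+n with m≤n⇒m<n∨m≡n m≤1+n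
... | inj₁ (s≤s m≤n) = ≤-trans (half-mono m≤n) (m≤m+n (half n) (parity n))
... | inj₂ refl      = ≤-refl

halves-suc : ∀ x t → halves (suc x) t ≡ halves x (half t)
halves-suc zero    t = refl
halves-suc (suc x) t = cong half (halves-suc x t)

halves-zero : ∀ x → halves x 0 ≡ 0
halves-zero zero    = refl
halves-zero (suc x) = cong half (halves-zero x)

halves-pos : ∀ x {t} → 2 ^ x ≤ t → 1 ≤ halves x t
halves-pos zero            1≤t = 1≤t
halves-pos (suc x) {t} 2^x+1≤t = subst (1 ≤_) (sym (halves-suc x t))
  (halves-pos x (subst (_≤ half t) (half-+2* 0 (2 ^ x)) (half-mono 2^x+1≤t)))

parity-encode : ∀ ℓ X → parity (encode (suc ℓ) X) ≡ χ (X 0)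
parity-encode ℓ X = trans (parity-+2* (χ (X 0)) (encode ℓ (X ∘ suc))) (parity-χ (X 0))

half-encode : ∀ ℓ X → half (encode (suc ℓ) X) ≡ encode ℓ (X ∘ suc)
half-encode ℓ X = trans (half-+2* (χ (X 0)) (encode ℓ (X ∘ suc))) (cong (_+ encode ℓ (X ∘ suc)) (half-χ (X 0)))

halves-encode : ∀ x ℓ X → halves (suc x) (encode (suc ℓ) X) ≡ halves x (encode ℓ (X ∘ suc))
halves-encode x ℓ X = trans (halves-suc x _) (cong (halves x) (half-encode ℓ X))

encode-digit : ∀ ℓ X x → x < ℓ → parity (halves x (encode ℓ X)) ≡ χ (X x)
encode-digit (suc ℓ) X zero    _         = parity-encode ℓ X
encode-digit (suc ℓ) X (suc x) (s≤s x<ℓ) =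
  trans (cong parity (halves-encode x ℓ X)) (encode-digit ℓ (X ∘ suc) x x<ℓ)

encode-high : ∀ ℓ X x → ℓ ≤ x → halves (suc x) (encode ℓ X) ≡ 0
encode-high zero    X x       _         = trans (halves-suc x 1) (halves-zero x)
encode-high (suc ℓ) X (suc x) (s≤s ℓ≤x) =
  trans (halves-encode (suc x) ℓ X) (encode-high ℓ (X ∘ suc) x ℓ≤x)

encode-length : ∀ ℓ X x → 1 ≤ halves (suc x) (encode ℓ X) → x < ℓ
encode-length ℓ X x long = ≰⇒> λ ℓ≤x → 1+n≰n (subst (1 ≤_) (encode-high ℓ X x ℓ≤x) long)

ℓ<encode : ∀ ℓ X → ℓ < encode ℓ X
ℓ<encode zero    X = s≤s z≤n
ℓ<encode (suc ℓ) X = begin-strict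
  suc ℓ            <⟨ s≤s ℓ<e ⟩
  suc e            ≡⟨ +-comm 1 e ⟩
  e + 1            ≤⟨ +-monoʳ-≤ e (≤-trans (s≤s z≤n) ℓ<e) ⟩
  e + e            ≡⟨ cong (e +_) (+-identityʳ e) ⟨
  2 * e            ≤⟨ m≤n+m (2 * e) (χ (X 0)) ⟩
  encode (suc ℓ) X ∎
  where
  open ≤-Reasoning
  e : ℕ
  e = encode ℓ (X ∘ suc)
  ℓ<e : ℓ < e
  ℓ<e = ℓ<encode ℓ (X ∘ suc)

decode-digit : ∀ X x {t} → ∃[ ℓ ] (encode ℓ X ≡ t) → 1 ≤ halves (suc x) t →
               parity (halves x t) ≡ χ (X x)
decode-digit X x (ℓ , refl) long = encode-digit ℓ X x (encode-length ℓ X x long)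

isCode? : ∀ X t → Dec (∃[ ℓ ] (ℓ < t × encode ℓ X ≡ t))
isCode? X t = anyUpTo? (λ ℓ → encode ℓ X ≟ t) t

codeBlocks : Set⊆ℕ → Set⊆ℕ
codeBlocks X b = isYes (isCode? X (level b))

codeBlocks-sound : ∀ X b → codeBlocks X b ≡ true → ∃[ ℓ ] (encode ℓ X ≡ level b)
codeBlocks-sound X b b∈A with ℓ , _ , code ← toWitness (Equivalence.from T-≡ b∈A) = ℓ , code

codeBlocks-complete : ∀ ℓ X b → level b ≡ encode ℓ X → codeBlocks X b ≡ true
codeBlocks-complete ℓ X b level≡code =
  Equivalence.to T-≡ (fromWitness (ℓ , subst (ℓ <_) (sym level≡code) (ℓ<encode ℓ X) , sym level≡code))

χ≤count : ∀ A n → χ (A n) ≤ count A n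
χ≤count A zero    = ≤-refl
χ≤count A (suc n) = m≤m+n (χ (A (suc n))) (count A n)

count-interval : ∀ A s d → (∀ i → i ≤ d → A (i + s) ≡ true) → suc d ≤ count A (d + s)
count-interval A s zero    full = subst (λ c → χ c ≤ count A s) (full 0 z≤n) (χ≤count A s)
count-interval A s (suc d) full with A (suc (d + s)) | full (suc d) ≤-refl
... | .true | refl = s≤s (count-interval A s d (λ i i≤d → full i (m≤n⇒m≤1+n i≤d)))

interval-ratio : ∀ k t s → k ≤ t → k * suc (t * s + s) ≤ suc k * suc (t * s)
interval-ratio k t s k≤t = begin
  k * suc (t * s + s)           ≡⟨ distribute k (t * s) s ⟩
  k * s + k * suc (t * s)       ≤⟨ +-monoˡ-≤ (k * suc (t * s)) (≤-trans (*-monoˡ-≤ s k≤t) (n≤1+n (t * s))) ⟩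
  suc (t * s) + k * suc (t * s) ∎
  where
  open ≤-Reasoning
  distribute : ∀ k p s → k * suc (p + s) ≡ k * s + k * suc p
  distribute = solve-∀

codeBlocks-dense : ∀ X → UpperDensityOne (codeBlocks X)
codeBlocks-dense X k m =
  t * s + s , m≤n , ≤-trans (interval-ratio k t s k≤t) (*-monoʳ-≤ (suc k) block⊆A)
  where
  t s : ℕ
  t = encode (k + m) X
  s = blockStart t
  k+m<t : k + m < t
  k+m<t = ℓ<encode (k + m) X
  k≤t : k ≤ t
  k≤t = ≤-trans (m≤m+n k m) (<⇒≤ k+m<t)
  m≤n : m ≤ t * s + s
  m≤n = ≤-trans (≤-trans (m≤n+m m k) (<⇒≤ k+m<t)) (≤-trans (n≤blockStart t) (m≤n+m s (t * s)))
  block⊆A : suc (t * s) ≤ count (codeBlocks X) (t * s + s)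
  block⊆A = count-interval (codeBlocks X) s (t * s) λ i i≤ts →
    codeBlocks-complete (k + m) X (i + s)
      (level-unique (m≤n+m s i) (s≤s (≤-trans (+-monoˡ-≤ s i≤ts) (≤-reflexive (+-comm (t * s) s)))))

levelᶜ : Code 1
levelᶜ = muᶜ (comp₂ monusᶜ (comp₁ blockStartᶜ (comp₁ succᶜ π₀)) (comp₁ succᶜ π₁))

searchᶜ : Code 2
searchᶜ = comp₂ addᶜ (comp₂ monusᶜ (comp₁ oracleᶜ π₀) one)
                     (comp₂ monusᶜ (comp₂ halvesᶜ (comp₁ succᶜ π₁) (comp₁ levelᶜ π₀)) one)

decodeᶜ : Code 2
decodeᶜ = comp₁ parityᶜ (comp₂ halvesᶜ π₁ (comp₁ levelᶜ π₀))

Φᶜ : Code 1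
Φᶜ = comp₂ decodeᶜ (muᶜ searchᶜ) π₀

-- Vanishes exactly when y is in the oracle and level y ≥ 2^(x+1).
searchValue : (ℕ → ℕ) → ℕ → ℕ → ℕ
searchValue o x y = (1 ∸ o y) + (1 ∸ halves (suc x) (level y))

module _ {o : ℕ → ℕ} where

  eval-level : ∀ b → Eval o levelᶜ (b ∷ []) (level b)
  eval-level b = eval-μ-least (λ z → suc b ∸ blockStart (suc z))
    (λ z → eval-comp₂ (eval-comp₁ (eval-comp₁ ev-proj ev-succ) (eval-blockStart _))
                      (eval-comp₁ ev-proj ev-succ) (eval-monus _ _))
    (m≤n⇒m∸n≡0 (proj₂ (level-bounds b)))
    (λ z<level b<next → <⇒≱ z<level (level-≤ (m∸n≡0⇒m≤n b<next)))

  eval-search : ∀ x y → Eval o searchᶜ (y ∷ x ∷ []) (searchValue o x y)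
  eval-search x y = eval-comp₂
    (eval-comp₂ (eval-comp₁ ev-proj ev-oracle) eval-one (eval-monus _ _))
    (eval-comp₂ (eval-comp₂ (eval-comp₁ ev-proj ev-succ) (eval-comp₁ ev-proj (eval-level y))
                            (eval-halves _ _))
                eval-one (eval-monus _ _))
    (eval-add _ _)

  eval-decode : ∀ x y → Eval o decodeᶜ (y ∷ x ∷ []) (parity (halves x (level y)))
  eval-decode x y = eval-comp₁
    (eval-comp₂ ev-proj (eval-comp₁ ev-proj (eval-level y)) (eval-halves _ _)) (eval-parity _)

χ-true : ∀ {c} → 1 ≤ χ c → c ≡ true
χ-true {true} _ = refl

searchValue-zero : ∀ B x y → B y ≡ true → 2 ^ suc x ≤ level y → searchValue (χ ∘ B) x y ≡ 0
searchValue-zero B x y y∈B large =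
  cong₂ _+_ (cong (λ c → 1 ∸ χ c) y∈B) (m≤n⇒m∸n≡0 (halves-pos (suc x) large))

searchValue-zero⁻¹ : ∀ B x y → searchValue (χ ∘ B) x y ≡ 0 →
                     B y ≡ true × 1 ≤ halves (suc x) (level y)
searchValue-zero⁻¹ B x y vanishes =
  χ-true (m∸n≡0⇒m≤n (m+n≡0⇒m≡0 _ vanishes)) , m∸n≡0⇒m≤n (m+n≡0⇒n≡0 _ vanishes)

Φᶜ-computes : ∀ X B → B ⊆ codeBlocks X → Infinite B → Computes Φᶜ B X
Φᶜ-computes X B B⊆A B-infinite x =
  let b , b-large , b∈B = B-infinite (blockStart (2 ^ suc x))
      y , μ↓ , vanishes = eval-μ-some (searchValue (χ ∘ B) x) (eval-search x) b
                            (searchValue-zero B x b b∈B (level-≥ b-large))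
      y∈B , long = searchValue-zero⁻¹ B x y vanishes
      digit = decode-digit X x (codeBlocks-sound X y (B⊆A y y∈B)) long
  in  eval-comp₂ μ↓ ev-proj (subst (Eval (χ ∘ B) decodeᶜ (y ∷ x ∷ [])) digit (eval-decode x y))

proposition4p1 : (X : Set⊆ℕ) →
    ∃[ A ] (UpperDensityOne A ×
      ∃[ Φ ] (∀ (B : Set⊆ℕ) → B ⊆ A → Infinite B → Computes Φ B X))
proposition4p1 X = codeBlocks X , codeBlocks-dense X , Φᶜ , Φᶜ-computes X
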